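{- For every integer $n \geq 4$, the radio number of the $n$-gear graph $G_n$ is $rn(G_n) = 4n+2$.
   Context: All graphs are simple and connected; $d(u,v)$ is the graph distance and $\operatorname{diam}(G)$ the diameter. A radio labeling of $G$ is a one-to-one map $c: V(G) \to \mathbb{Z}_{+}$ (positive integers) such that $d(u,v) + |c(u)-c(v)| \geq \operatorname{diam}(G)+1$ for all distinct $u,v \in V(G)$. The span of $c$ is the maximum value of $c$; the radio number $rn(G)$ is the minimum span over all radio labelings of $G$. The $n$-gear $G_n$ is the graph consisting of a cycle on $2n$ vertices together with an additional center vertex adjacent to every other vertex of the cycle (equivalently, the wheel $W_n$ with a new vertex inserted on each edge of its rim); it has $2n+1$ vertices and $3n$ edges. -}

module Defs where

open import Data.Nat using (ℕ; zero; suc; _+_; _*_; _≤_; _%_; _⊔_; ∣_-_∣)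
open import Data.Fin using (Fin; toℕ)
import Data.Fin as F
open import Data.List using (List; foldr; map; allFin)
open import Data.Product using (_×_; Σ; ∃; ∃-syntax; _,_)
open import Data.Sum using (_⊎_)
open import Data.Empty using (⊥)
open import Relation.Binary.PropositionalEquality using (_≡_; _≢_)

record Graph (N : ℕ) : Set₁ where
  field
    Adj : Fin N → Fin N → Set

open Graph public

data Walk {N : ℕ} (G : Graph N) : Fin N → Fin N → ℕ → Set where
  stay : ∀ u → Walk G u u 0
  step : ∀ {u v w k} → Adj G u v → Walk G v w k → Walk G u w (suc k)

Dist : ∀ {N} → Graph N → Fin N → Fin N → ℕ → Set
Dist G u v k = Walk G u v k × (∀ j → Walk G u v j → k ≤ j)

IsDiam : ∀ {N} → Graph N → ℕ → Set
IsDiam G D =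
  (∀ u v → ∃[ k ] (Dist G u v k × k ≤ D)) × (∃[ u ] ∃[ v ] Dist G u v D)

IsRadioLabeling : ∀ {N} → Graph N → ℕ → (Fin N → ℕ) → Set
IsRadioLabeling G D c =
  (∀ u → 1 ≤ c u)
  × (∀ u v → c u ≡ c v → u ≡ v)
  × (∀ u v k → u ≢ v → Dist G u v k → suc D ≤ k + ∣ c u - c v ∣)

span : ∀ {N} → (Fin N → ℕ) → ℕ
span {N} c = foldr _⊔_ 0 (map c (allFin N))

RadioNumberIs : ∀ {N} → Graph N → ℕ → ℕ → Set
RadioNumberIs {N} G D r =
  (∃[ c ] (IsRadioLabeling G D c × span c ≡ r))
  × (∀ c → IsRadioLabeling G D c → r ≤ span c)

-- The n-gear G_n: vertex F.zero is the center, F.suc i (i : Fin (2n)) are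
-- the cycle vertices x_0,...,x_{2n-1}; the center is adjacent to x_i for i even.
CycAdj : (n : ℕ) → Fin (2 * n) → Fin (2 * n) → Set
CycAdj n i j =
  (toℕ j ≡ suc (toℕ i)) ⊎ (suc (toℕ i) ≡ 2 * n × toℕ j ≡ 0)

GearAdj : (n : ℕ) → Fin (suc (2 * n)) → Fin (suc (2 * n)) → Set
GearAdj n F.zero F.zero = ⊥
GearAdj n F.zero (F.suc j) = toℕ j % 2 ≡ 0
GearAdj n (F.suc i) F.zero = toℕ i % 2 ≡ 0
GearAdj n (F.suc i) (F.suc j) = CycAdj n i j ⊎ CycAdj n j i

gear : (n : ℕ) → Graph (suc (2 * n))
gear n = record { Adj = GearAdj n }

module Submission where

-- The vertices are the hub and the rim vertices x_0, …, x_{2n-1}; x_i is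
-- joined to the hub iff i is even, so it lies at distance spoke i ∈ {1, 2}
-- from the hub.  Routing through the hub gives d(u,v) ≤ height u + height v.
--   Conversely the potential gear-lb (rim distance, or the route through the
--   hub) drops by at most one per edge, so it bounds d from below.  Hence
--   diam G_n = 4, attained by x_1 and x_5.
-- * Upper bound.  The hub gets 1 and x_i gets ℓ i, where ℓ (2m) = 4m + 6 and
--   ℓ (2m + 1) = 4m, except that x_1 gets ℓ (2n + 1) = 4n.  Two rim labels
--   differ by at least 4, or by 2 for vertices of opposite parity that are
--   3 to 5 apart on the rim (hence at distance 3); this is the radio
--   condition, and the largest label is 4n + 2.
-- * Lower bound.  For any graph, sorting the vertices by label and adding up
--   the gaps forced by the radio condition bounds the span (module
--   RadioLowerBound); for G_n the heights sum to 3n, giving span ≥ 4n + 2.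

open import Defs
open import Data.Nat using (ℕ; zero; suc; _+_; _*_; _∸_; _≤_; _<_; _%_; _⊓_; _⊔_; ∣_-_∣; z≤n; s≤s)
open import Data.Nat.Properties
open import Data.Nat.DivMod using (m%n<n; [m+kn]%n≡m%n)
open import Data.Nat.ListAction using (sum)
open import Data.Nat.ListAction.Properties using (sum-↭)
open import Data.Nat.Tactic.RingSolver using (solve-∀)
open import Data.Fin as F using (Fin; toℕ)
import Data.Fin.Properties as FinP
open import Data.List using (List; []; _∷_; foldr; map; allFin; length; tabulate)
open import Data.List.Properties using (length-tabulate; map-tabulate)
open import Data.List.Membership.Propositional using (_∈_)
open import Data.List.Membership.Propositional.Properties using (∈-allFin)
open import Data.List.Relation.Unary.Any using (here; there)
import Data.List.Relation.Unary.All as All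
open import Data.List.Relation.Unary.AllPairs using (AllPairs; _∷_)
open import Data.List.Relation.Unary.Linked using (Linked; []; [-]; _∷_)
open import Data.List.Relation.Unary.Unique.Propositional.Properties using (allFin⁺)
open import Data.List.Relation.Binary.Permutation.Propositional using (_↭_; ↭-sym; ↭⇒↭ₛ)
open import Data.List.Relation.Binary.Permutation.Propositional.Properties using (↭-length; map⁺)
import Data.List.Relation.Binary.Permutation.Setoid.Properties as PermSetoid
import Data.List.Sort as Sort
import Relation.Binary.Construct.On as On
open import Data.Product using (_×_; ∃-syntax; _,_; proj₁; proj₂)
open import Data.Sum using (_⊎_; inj₁; inj₂; [_,_])
open import Function using (_∘_)
open import Relation.Nullary using (¬_; Dec; yes; no; contradiction)
open import Relation.Nullary.Decidable using (_×-dec_; _⊎-dec_)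
open import Relation.Binary.PropositionalEquality using (_≡_; _≢_; refl; sym; trans; cong; subst; cong₂; module ≡-Reasoning)
open import Relation.Binary.PropositionalEquality.Properties using (setoid)

bounded-search : {P : ℕ → Set} → (∀ i → Dec (P i)) → ∀ k →
                 (∀ j → j ≤ k → ¬ P j) ⊎ (∃[ m ] (P m × (∀ j → P j → m ≤ j)))
bounded-search P? zero with P? zero
... | yes p0 = inj₂ (zero , p0 , λ _ _ → z≤n)
... | no ¬p0 = inj₁ λ { zero z≤n → ¬p0 }
bounded-search P? (suc k) with bounded-search P? k
... | inj₂ w = inj₂ w
... | inj₁ none with P? (suc k)
...   | yes p = inj₂ (suc k , p , λ j pj → ≰⇒> (λ j≤k → none j j≤k pj))
...   | no ¬p = inj₁ λ j j≤1+k → [ (λ j<1+k → none j (≤-pred j<1+k)) , (λ { refl → ¬p }) ]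
                                    (m≤n⇒m<n∨m≡n j≤1+k)

least-witness : {P : ℕ → Set} → (∀ i → Dec (P i)) → ∀ {k} → P k →
                ∃[ m ] (P m × (∀ j → P j → m ≤ j))
least-witness P? {k} pk with bounded-search P? k
... | inj₁ none = contradiction pk (none k ≤-refl)
... | inj₂ w = w

module _ {N : ℕ} {G : Graph N} where

  _++ʷ_ : ∀ {u v w a b} → Walk G u v a → Walk G v w b → Walk G u w (a + b)
  stay _ ++ʷ q = q
  step e p ++ʷ q = step e (p ++ʷ q)

  snoc : ∀ {u v w k} → Walk G u v k → Adj G v w → Walk G u w (suc k)
  snoc (stay _) e = step e (stay _)
  snoc (step e p) e′ = step e (snoc p e′)

  reverse : (∀ {u v} → Adj G u v → Adj G v u) → ∀ {u v k} → Walk G u v k → Walk G v u k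
  reverse adj-sym (stay u) = stay u
  reverse adj-sym (step e p) = snoc (reverse adj-sym p) (adj-sym e)

  walk? : (∀ u v → Dec (Adj G u v)) → ∀ u v k → Dec (Walk G u v k)
  walk? adj? u v zero with u F.≟ v
  ... | yes refl = yes (stay u)
  ... | no u≢v = no λ { (stay _) → u≢v refl }
  walk? adj? u v (suc k) with FinP.any? (λ w → adj? u w ×-dec walk? adj? w v k)
  ... | yes (w , e , p) = yes (step e p)
  ... | no ∄w = no λ { (step e p) → ∄w (_ , e , p) }

  distance-≤ : (∀ u v → Dec (Adj G u v)) → ∀ {u v k} → Walk G u v k →
               ∃[ d ] (Dist G u v d × d ≤ k)
  distance-≤ adj? {u} {v} p with least-witness (walk? adj? u v) p
  ... | d , q , shortest = d , (q , shortest) , shortest _ p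

  potential-≤ : (φ : Fin N → Fin N → ℕ) → (∀ u → φ u u ≡ 0) →
                (∀ {u v} w → Adj G u v → φ u w ≤ suc (φ v w)) →
                ∀ {u v k} → Walk G u v k → φ u v ≤ k
  potential-≤ φ φ-diag φ-step (stay u) = ≤-reflexive (φ-diag u)
  potential-≤ φ φ-diag φ-step {v = v} (step e p) =
    ≤-trans (φ-step v e) (s≤s (potential-≤ φ φ-diag φ-step p))

max-≥ : ∀ {A : Set} (f : A → ℕ) {x xs} → x ∈ xs → f x ≤ foldr _⊔_ 0 (map f xs)
max-≥ f {xs = y ∷ _} (here refl) = m≤m⊔n (f y) _
max-≥ f {xs = y ∷ _} (there x∈) = ≤-trans (max-≥ f x∈) (m≤n⊔m (f y) _)

max-≤ : ∀ {A : Set} (f : A → ℕ) {b} → (∀ x → f x ≤ b) → ∀ xs → foldr _⊔_ 0 (map f xs) ≤ b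
max-≤ f f≤b [] = z≤n
max-≤ f f≤b (x ∷ xs) = ⊔-lub (f≤b x) (max-≤ f f≤b xs)

≤-span : ∀ {N} (c : Fin N → ℕ) u → c u ≤ span c
≤-span c u = max-≥ c (∈-allFin u)

-- Arithmetic of one step of the telescoping sum in the radio lower bound:
-- labels cx ≤ cy ≤ … ≤ cz, levels hx, hy, hz, required gap s, chain length L
-- after y, and level sum S after y.
telescope-step : ∀ cx cy cz hx hy hz s L S → cx + s ≤ cy + hx + hy →
                 cy + L * s + hy + hz ≤ cz + 2 * (hy + S) →
                 cx + suc L * s + hx + hz ≤ cz + 2 * (hx + (hy + S))
telescope-step cx cy cz hx hy hz s L S first rest = +-cancelʳ-≤ (cy + hy) _ _ (begin
    cx + suc L * s + hx + hz + (cy + hy)            ≡⟨ lhs cx cy hx hy hz s L ⟩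
    (cx + s) + (cy + L * s + hy + hz) + hx          ≤⟨ +-monoˡ-≤ hx (+-mono-≤ first rest) ⟩
    (cy + hx + hy) + (cz + 2 * (hy + S)) + hx       ≡⟨ rhs cy cz hx hy S ⟩
    cz + 2 * (hx + (hy + S)) + (cy + hy)            ∎)
  where
  open ≤-Reasoning
  lhs : ∀ a b p q r s L → a + suc L * s + p + r + (b + q) ≡ (a + s) + (b + L * s + q + r) + p
  lhs = solve-∀
  rhs : ∀ b z p q S → (b + p + q) + (z + 2 * (q + S)) + p ≡ z + 2 * (p + (q + S)) + (b + q)
  rhs = solve-∀

-- If every distance satisfies d(u,v) ≤ h u + h v for a
-- level function h, list the vertices by increasing label: consecutive labels
-- differ by at least D + 1 - h u - h v, and summing these gaps along the list
-- gives, for the first vertex x and the last vertex z,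
--   c x + M (D + 1) + h x + h z ≤ span c + 2 Σ h.
module RadioLowerBound {M D : ℕ} {G : Graph (suc M)} (h : Fin (suc M) → ℕ)
         (dist-via : ∀ u v → ∃[ k ] (Dist G u v k × k ≤ h u + h v))
         {c : Fin (suc M) → ℕ} (radio : IsRadioLabeling G D c) where

  V : Set
  V = Fin (suc M)

  Gap : V → V → Set
  Gap u v = c u + suc D ≤ c v + h u + h v

  gap : ∀ {u v} → u ≢ v → c u ≤ c v → Gap u v
  gap {u} {v} u≢v cu≤cv with dist-via u v
  ... | k , d , k≤ = begin
      c u + suc D                       ≤⟨ +-monoʳ-≤ (c u) (radio-condition u v k u≢v d) ⟩
      c u + (k + ∣ c u - c v ∣)         ≤⟨ +-monoʳ-≤ (c u) (+-mono-≤ k≤ (≤-reflexive (m≤n⇒∣m-n∣≡n∸m cu≤cv))) ⟩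
      c u + (h u + h v + (c v ∸ c u))   ≡⟨ regroup (c u) (c v ∸ c u) (h u) (h v) ⟩
      c u + (c v ∸ c u) + h u + h v     ≡⟨ cong (λ t → t + h u + h v) (m+[n∸m]≡n cu≤cv) ⟩
      c v + h u + h v                   ∎
    where
    open ≤-Reasoning
    radio-condition : ∀ u v k → u ≢ v → Dist G u v k → suc D ≤ k + ∣ c u - c v ∣
    radio-condition = proj₂ (proj₂ radio)
    regroup : ∀ a x p q → a + (p + q + x) ≡ a + x + p + q
    regroup = solve-∀

  last : V → List V → V
  last x [] = x
  last _ (y ∷ ys) = last y ys

  last-∈ : ∀ y ys → last y ys ∈ y ∷ ys
  last-∈ y [] = here refl
  last-∈ _ (y ∷ ys) = there (last-∈ y ys)

  telescope : ∀ x xs → Linked Gap (x ∷ xs) →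
              c x + length xs * suc D + h x + h (last x xs)
                ≤ c (last x xs) + 2 * sum (map h (x ∷ xs))
  telescope x [] _ = ≤-reflexive (single (c x) (h x) (suc D))
    where
    single : ∀ a p s → a + 0 * s + p + p ≡ a + 2 * (p + 0)
    single = solve-∀
  telescope x (y ∷ ys) (g ∷ gs) =
    telescope-step (c x) (c y) (c z) (h x) (h y) (h z) (suc D) (length ys)
                   (sum (map h ys)) g (telescope y ys gs)
    where
    z : V
    z = last y ys

  sorted⇒gaps : ∀ {xs} → Linked (λ u v → c u ≤ c v) xs → AllPairs _≢_ xs → Linked Gap xs
  sorted⇒gaps [] _ = []
  sorted⇒gaps [-] _ = [-]
  sorted⇒gaps (cu≤cv ∷ sorted) (u≢ ∷ distinct) =
    gap (All.head u≢) cu≤cv ∷ sorted⇒gaps sorted distinct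

  SpanBound : Set
  SpanBound = ∃[ x ] ∃[ z ] (x ≢ z ×
    c x + M * suc D + h x + h z ≤ span c + 2 * sum (map h (allFin (suc M))))

  length-order : ∀ {xs} → xs ↭ allFin (suc M) → length xs ≡ suc M
  length-order perm = trans (↭-length perm) (length-tabulate {n = suc M} (λ u → u))

  bound-from-order : 1 ≤ M → ∀ xs → xs ↭ allFin (suc M) →
                     Linked (λ u v → c u ≤ c v) xs → AllPairs _≢_ xs → SpanBound
  bound-from-order 1≤M [] perm _ _ = contradiction (length-order perm) λ ()
  bound-from-order 1≤M (x ∷ []) perm _ _ =
    contradiction (subst (1 ≤_) (sym (suc-injective (length-order perm))) 1≤M) λ ()
  bound-from-order 1≤M (x ∷ y ∷ ys) perm sorted distinct@(x≢ ∷ _) =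
    x , z , All.lookup x≢ (last-∈ y ys) , (begin
      c x + M * suc D + h x + h z                 ≡⟨ cong (λ L → c x + L * suc D + h x + h z) (sym length≡M) ⟩
      c x + length (y ∷ ys) * suc D + h x + h z   ≤⟨ telescope x (y ∷ ys) (sorted⇒gaps sorted distinct) ⟩
      c z + 2 * sum (map h (x ∷ y ∷ ys))          ≤⟨ +-mono-≤ (≤-span c z) (≤-reflexive (cong (2 *_) (sum-↭ (map⁺ h perm)))) ⟩
      span c + 2 * sum (map h (allFin (suc M)))   ∎)
    where
    open ≤-Reasoning
    z : V
    z = last y ys
    length≡M : length (y ∷ ys) ≡ M
    length≡M = suc-injective (length-order perm)

  span-bound : 1 ≤ M → SpanBound
  span-bound 1≤M = bound-from-order 1≤M order (sort-↭ all) (sort-↗ all) distinct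
    where
    open Sort (On.decTotalOrder ≤-decTotalOrder c) using (sort; sort-↭; sort-↗)
    all : List V
    all = allFin (suc M)
    order : List V
    order = sort all
    distinct : AllPairs _≢_ order
    distinct = PermSetoid.Unique-resp-↭ (setoid V) (↭⇒↭ₛ (↭-sym (sort-↭ all))) (allFin⁺ (suc M))

pattern hub = F.zero
pattern rim i = F.suc i

Vertex : ℕ → Set
Vertex n = Fin (suc (2 * n))

-- Rim vertex x_i lies at distance spoke i from the hub: 1 if i is even, 2 if odd.
spoke : ℕ → ℕ
spoke i = suc (i % 2)

parity : ∀ i → i % 2 ≡ 0 ⊎ i % 2 ≡ 1
parity zero = inj₁ refl
parity (suc zero) = inj₂ refl
parity (suc (suc i)) = parity i

spoke≤2 : ∀ i → spoke i ≤ 2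
spoke≤2 i = m%n<n i 2

spoke-step : ∀ i j → spoke i ≤ suc (spoke j)
spoke-step i j = ≤-trans (spoke≤2 i) (s≤s (s≤s z≤n))

odd⇒suc-even : ∀ t → t % 2 ≡ 1 → ∃[ s ] (t ≡ suc s × s % 2 ≡ 0)
odd⇒suc-even (suc zero) _ = zero , refl , refl
odd⇒suc-even (suc (suc t)) t-odd with odd⇒suc-even t t-odd
... | s , refl , s-even = suc (suc s) , refl , s-even

height : ∀ n → Vertex n → ℕ
height n hub = 0
height n (rim i) = spoke (toℕ i)

gear-sym : ∀ n {u v} → GearAdj n u v → GearAdj n v u
gear-sym n {hub} {rim j} e = e
gear-sym n {rim i} {hub} e = e
gear-sym n {rim i} {rim j} (inj₁ e) = inj₂ e
gear-sym n {rim i} {rim j} (inj₂ e) = inj₁ e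

gear-adj? : ∀ n (u v : Vertex n) → Dec (GearAdj n u v)
gear-adj? n hub hub = no λ ()
gear-adj? n hub (rim j) = toℕ j % 2 ≟ 0
gear-adj? n (rim i) hub = toℕ i % 2 ≟ 0
gear-adj? n (rim i) (rim j) = cyc? i j ⊎-dec cyc? j i
  where
  cyc? : ∀ i j → Dec (CycAdj n i j)
  cyc? i j = (toℕ j ≟ suc (toℕ i)) ⊎-dec ((suc (toℕ i) ≟ 2 * n) ×-dec (toℕ j ≟ 0))

-- Every vertex reaches the hub in `height` steps (odd rim vertices via their
-- even predecessor on the rim).
to-hub : ∀ n u → Walk (gear n) u hub (height n u)
to-hub n hub = stay hub
to-hub n (rim i) with parity (toℕ i)
... | inj₁ i-even rewrite i-even = step i-even (stay hub)
... | inj₂ i-odd rewrite i-odd with odd⇒suc-even (toℕ i) i-odd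
... | s , i≡1+s , s-even = step (inj₂ (inj₁ i≡1+j)) (step j-even (stay hub))
  where
  s<2n : s < 2 * n
  s<2n = ≤-trans (n≤1+n (suc s)) (subst (_< 2 * n) i≡1+s (FinP.toℕ<n i))
  j : Fin (2 * n)
  j = F.fromℕ< s<2n
  i≡1+j : toℕ i ≡ suc (toℕ j)
  i≡1+j = trans i≡1+s (cong suc (sym (FinP.toℕ-fromℕ< s<2n)))
  j-even : toℕ j % 2 ≡ 0
  j-even = trans (cong (_% 2) (FinP.toℕ-fromℕ< s<2n)) s-even

via-hub : ∀ n u v → Walk (gear n) u v (height n u + height n v)
via-hub n u v = to-hub n u ++ʷ reverse (gear-sym n) (to-hub n v)

gear-dist-via-hub : ∀ n u v → ∃[ k ] (Dist (gear n) u v k × k ≤ height n u + height n v)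
gear-dist-via-hub n u v = distance-≤ (gear-adj? n) (via-hub n u v)

∸-suc-≤ : ∀ m a → m ∸ a ≤ suc (m ∸ suc a)
∸-suc-≤ zero zero = z≤n
∸-suc-≤ zero (suc a) = z≤n
∸-suc-≤ (suc m) zero = ≤-refl
∸-suc-≤ (suc m) (suc a) = ∸-suc-≤ m a

∣-∣-step : ∀ i k → ∣ i - k ∣ ≤ suc ∣ suc i - k ∣ × ∣ suc i - k ∣ ≤ suc ∣ i - k ∣
∣-∣-step zero zero = z≤n , s≤s z≤n
∣-∣-step zero (suc k) = ≤-refl , m≤n⇒m≤1+n (n≤1+n k)
∣-∣-step (suc i) zero = m≤n⇒m≤1+n (n≤1+n (suc i)) , ≤-refl
∣-∣-step (suc i) (suc k) = ∣-∣-step i k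

-- fold M a = min(a, M - a): the length of the shorter arc between two points
-- of a cycle of length M that lie at linear separation a.
fold : ℕ → ℕ → ℕ
fold M a = a ⊓ (M ∸ a)

fold-step : ∀ M {a b} → a ≤ suc b → b ≤ suc a → fold M a ≤ suc (fold M b)
fold-step M {a} {b} a≤1+b b≤1+a =
  ⊓-mono-≤ a≤1+b (≤-trans (∸-suc-≤ M a) (s≤s (∸-monoʳ-≤ M b≤1+a)))

fold-mirror : ∀ M {a} → a ≤ M → fold M (M ∸ a) ≡ fold M a
fold-mirror M {a} a≤M = trans (cong ((M ∸ a) ⊓_) (m∸[m∸n]≡n a≤M)) (⊓-comm (M ∸ a) a)

-- Across the wrap-around edge x_{2n-1} x_0 the separation from x_k is
-- measured the other way round the cycle.
fold-wrap : ∀ {M i k} → suc i ≡ M → k < M → fold M k ≡ fold M (suc ∣ i - k ∣)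
fold-wrap {M} {i} {k} 1+i≡M k<M = begin
    fold M k               ≡⟨ fold-mirror M (<⇒≤ k<M) ⟨
    fold M (M ∸ k)         ≡⟨ cong (λ m → fold M (m ∸ k)) 1+i≡M ⟨
    fold M (suc i ∸ k)     ≡⟨ cong (fold M) (+-∸-assoc 1 k≤i) ⟩
    fold M (suc (i ∸ k))   ≡⟨ cong (λ a → fold M (suc a)) (m≤n⇒∣n-m∣≡n∸m k≤i) ⟨
    fold M (suc ∣ i - k ∣) ∎
  where
  open ≡-Reasoning
  k≤i : k ≤ i
  k≤i = ≤-pred (subst (k <_) (sym 1+i≡M) k<M)

rim-dist : ℕ → ℕ → ℕ → ℕ
rim-dist n i k = fold (2 * n) ∣ i - k ∣

RimAdj : ℕ → ℕ → ℕ → Set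
RimAdj n i j = (j ≡ suc i) ⊎ (suc i ≡ 2 * n × j ≡ 0)

rim-dist-step : ∀ n {i j} k → k < 2 * n → RimAdj n i j ⊎ RimAdj n j i →
                rim-dist n i k ≤ suc (rim-dist n j k)
rim-dist-step n {i} k _ (inj₁ (inj₁ refl)) =
  fold-step (2 * n) (proj₁ (∣-∣-step i k)) (proj₂ (∣-∣-step i k))
rim-dist-step n {j = j} k _ (inj₂ (inj₁ refl)) =
  fold-step (2 * n) (proj₂ (∣-∣-step j k)) (proj₁ (∣-∣-step j k))
rim-dist-step n {i} k k<2n (inj₁ (inj₂ (1+i≡2n , refl))) =
  subst (λ t → rim-dist n i k ≤ suc t) (sym (fold-wrap 1+i≡2n k<2n))
        (fold-step (2 * n) (m≤n⇒m≤1+n (n≤1+n _)) ≤-refl)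
rim-dist-step n {j = j} k k<2n (inj₂ (inj₂ (1+j≡2n , refl))) =
  subst (λ t → t ≤ suc (rim-dist n j k)) (sym (fold-wrap 1+j≡2n k<2n))
        (fold-step (2 * n) ≤-refl (m≤n⇒m≤1+n (n≤1+n _)))

rim-dist-pos : ∀ n {i k} → i ≢ k → i < 2 * n → k < 2 * n → 1 ≤ rim-dist n i k
rim-dist-pos n {i} {k} i≢k i<2n k<2n = ⊓-glb apart (m<n⇒0<n∸m (begin-strict
    ∣ i - k ∣ ≤⟨ ∣m-n∣≤m⊔n i k ⟩
    i ⊔ k     <⟨ ⊔-lub i<2n k<2n ⟩
    2 * n     ∎))
  where
  open ≤-Reasoning
  apart : 1 ≤ ∣ i - k ∣
  apart = n≢0⇒n>0 (λ ∣i-k∣≡0 → i≢k (∣m-n∣≡0⇒m≡n ∣i-k∣≡0))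

-- A lower bound for gear distances (it is in fact the exact distance): the hub
-- is at distance spoke j from x_j, and a shortest path between rim vertices
-- runs either along the rim or through the hub.
gear-lb : ∀ n → Vertex n → Vertex n → ℕ
gear-lb n hub hub = 0
gear-lb n hub (rim k) = spoke (toℕ k)
gear-lb n (rim i) hub = spoke (toℕ i)
gear-lb n (rim i) (rim k) = rim-dist n (toℕ i) (toℕ k) ⊓ (spoke (toℕ i) + spoke (toℕ k))

gear-lb-diag : ∀ n u → gear-lb n u u ≡ 0
gear-lb-diag n hub = refl
gear-lb-diag n (rim i) rewrite ∣n-n∣≡0 (toℕ i) = refl

gear-lb-step : ∀ n {u v} w → GearAdj n u v → gear-lb n u w ≤ suc (gear-lb n v w)
gear-lb-step n {hub} {rim j} hub _ = z≤n
gear-lb-step n {hub} {rim j} (rim k) j-even = ⊓-glb along-rim through-hub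
  where
  along-rim : spoke (toℕ k) ≤ suc (rim-dist n (toℕ j) (toℕ k))
  along-rim with parity (toℕ k)
  ... | inj₁ k-even rewrite k-even = s≤s z≤n
  ... | inj₂ k-odd rewrite k-odd = s≤s (rim-dist-pos n j≢k (FinP.toℕ<n j) (FinP.toℕ<n k))
    where
    j≢k : toℕ j ≢ toℕ k
    j≢k j≡k with trans (sym j-even) (trans (cong (_% 2) j≡k) k-odd)
    ... | ()
  through-hub : spoke (toℕ k) ≤ suc (spoke (toℕ j) + spoke (toℕ k))
  through-hub = m≤n⇒m≤1+n (m≤n+m (spoke (toℕ k)) (spoke (toℕ j)))
gear-lb-step n {rim i} {hub} hub i-even = ≤-reflexive (cong suc i-even)
gear-lb-step n {rim i} {hub} (rim k) i-even =
  ≤-trans (m⊓n≤n _ _) (≤-reflexive (cong (λ p → suc p + spoke (toℕ k)) i-even))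
gear-lb-step n {rim i} {rim j} hub _ = spoke-step (toℕ i) (toℕ j)
gear-lb-step n {rim i} {rim j} (rim k) rim-edge =
  ⊓-mono-≤ (rim-dist-step n (toℕ k) (FinP.toℕ<n k) rim-edge)
           (+-monoˡ-≤ (spoke (toℕ k)) (spoke-step (toℕ i) (toℕ j)))

gear-lb-≤ : ∀ n {u v k} → Walk (gear n) u v k → gear-lb n u v ≤ k
gear-lb-≤ n = potential-≤ (gear-lb n) (gear-lb-diag n) (gear-lb-step n)

height≤2 : ∀ n u → height n u ≤ 2
height≤2 n hub = z≤n
height≤2 n (rim i) = spoke≤2 (toℕ i)

2n≥8 : ∀ {n} → 4 ≤ n → 8 ≤ 2 * n
2n≥8 = *-monoʳ-≤ 2

-- x_1 and x_5 are at distance 4: they are joined through the hub, and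
-- around the rim they are 4 ≤ 2n - 4 steps apart.
diametral-pair : ∀ n → 4 ≤ n → ∃[ u ] ∃[ v ] Dist (gear n) u v 4
diametral-pair n n≥4 = rim x₁ , rim x₅ , path , λ k walk → ≤-trans lb≥4 (gear-lb-≤ n walk)
  where
  1<2n : 1 < 2 * n
  1<2n = ≤-trans (s≤s (s≤s z≤n)) (2n≥8 n≥4)
  5<2n : 5 < 2 * n
  5<2n = ≤-trans (s≤s (s≤s (s≤s (s≤s (s≤s (s≤s z≤n)))))) (2n≥8 n≥4)
  x₁ x₅ : Fin (2 * n)
  x₁ = F.fromℕ< 1<2n
  x₅ = F.fromℕ< 5<2n
  index₁ : toℕ x₁ ≡ 1
  index₁ = FinP.toℕ-fromℕ< 1<2n
  index₅ : toℕ x₅ ≡ 5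
  index₅ = FinP.toℕ-fromℕ< 5<2n
  path : Walk (gear n) (rim x₁) (rim x₅) 4
  path = subst (Walk (gear n) (rim x₁) (rim x₅))
               (cong₂ (λ a b → spoke a + spoke b) index₁ index₅) (via-hub n (rim x₁) (rim x₅))
  lb≥4 : 4 ≤ gear-lb n (rim x₁) (rim x₅)
  lb≥4 rewrite index₁ | index₅ = ⊓-glb (⊓-glb ≤-refl (m+n≤o⇒m≤o∸n 4 (2n≥8 n≥4))) ≤-refl

gear-diameter : ∀ n → 4 ≤ n → IsDiam (gear n) 4
gear-diameter n n≥4 = within-4 , diametral-pair n n≥4
  where
  within-4 : ∀ u v → ∃[ k ] (Dist (gear n) u v k × k ≤ 4)
  within-4 u v with gear-dist-via-hub n u v
  ... | k , d , k≤ = k , d , ≤-trans k≤ (+-mono-≤ (height≤2 n u) (height≤2 n v))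

-- The labels used on the rim, indexed by an "unrolled" rim position:
-- ℓ (2m) = 4m + 6 and ℓ (2m + 1) = 4m.  Shifting a position by two adds four.
ℓ : ℕ → ℕ
ℓ zero = 6
ℓ (suc zero) = 0
ℓ (suc (suc k)) = 4 + ℓ k

Separated : ℕ → ℕ → Set
Separated i j = 4 ≤ ∣ ℓ i - ℓ j ∣
              ⊎ (3 ≤ ∣ i - j ∣ × ∣ i - j ∣ ≤ 5 × 3 ≤ spoke i + spoke j × 2 ≤ ∣ ℓ i - ℓ j ∣)

separated-sym : ∀ i j → Separated i j → Separated j i
separated-sym i j s rewrite ∣-∣-comm (ℓ i) (ℓ j) | ∣-∣-comm i j | +-comm (spoke i) (spoke j) = s

separated-from-0 : ∀ j → j ≢ 0 → Separated 0 j
separated-from-0 zero 0≢0 = contradiction refl 0≢0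
separated-from-0 1 _ = inj₁ (m≤m+n 4 2)
separated-from-0 2 _ = inj₁ ≤-refl
separated-from-0 3 _ = inj₂ (≤-refl , m≤m+n 3 2 , ≤-refl , ≤-refl)
separated-from-0 4 _ = inj₁ (m≤m+n 4 4)
separated-from-0 5 _ = inj₂ (m≤m+n 3 2 , ≤-refl , ≤-refl , ≤-refl)
separated-from-0 (suc (suc (suc (suc (suc (suc k)))))) _ = inj₁ (m≤m+n 4 (2 + ℓ k))

separated-from-1 : ∀ j → j ≢ 1 → Separated 1 j
separated-from-1 zero _ = inj₁ (m≤m+n 4 2)
separated-from-1 1 1≢1 = contradiction refl 1≢1
separated-from-1 (suc (suc k)) _ = inj₁ (m≤m+n 4 (ℓ k))

-- Any two distinct positions are separated: shifting both by two changes
-- neither the label difference nor the parities, reducing to positions 0 and 1.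
separated : ∀ i j → i ≢ j → Separated i j
separated zero j i≢j = separated-from-0 j (i≢j ∘ sym)
separated 1 j i≢j = separated-from-1 j (i≢j ∘ sym)
separated (suc (suc i)) zero _ = separated-sym 0 (suc (suc i)) (separated-from-0 (suc (suc i)) λ ())
separated (suc (suc i)) 1 _ = separated-sym 1 (suc (suc i)) (separated-from-1 (suc (suc i)) λ ())
separated (suc (suc i)) (suc (suc j)) i≢j = separated i j (i≢j ∘ cong (λ k → suc (suc k)))

-- The unrolled position of rim vertex x_i: x_1 is moved to position 2n + 1,
-- so that its label is ℓ (2n + 1) = 4n.
unroll : ℕ → ℕ → ℕ
unroll n zero = zero
unroll n (suc zero) = suc (2 * n)
unroll n (suc (suc i)) = suc (suc i)

-- Unrolling moves by a multiple of the rim length, so parities are kept.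
spoke-unroll : ∀ n i → spoke (unroll n i) ≡ spoke i
spoke-unroll n zero = refl
spoke-unroll n (suc zero) =
  cong suc (trans (cong (λ m → suc m % 2) (*-comm 2 n)) ([m+kn]%n≡m%n 1 n 2))
spoke-unroll n (suc (suc i)) = refl

unroll-injective : ∀ n {i j} → i < 2 * n → j < 2 * n → unroll n i ≡ unroll n j → i ≡ j
unroll-injective n {zero} {zero} _ _ _ = refl
unroll-injective n {zero} {suc zero} _ _ ()
unroll-injective n {suc zero} {zero} _ _ ()
unroll-injective n {suc zero} {suc zero} _ _ _ = refl
unroll-injective n {suc zero} {suc (suc j)} _ j<2n eq = contradiction (subst (_< 2 * n) (sym eq) j<2n) (1+n≰n ∘ <⇒≤)
unroll-injective n {suc (suc i)} {suc zero} i<2n _ eq = contradiction (subst (_< 2 * n) eq i<2n) (1+n≰n ∘ <⇒≤)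
unroll-injective n {suc (suc i)} {suc (suc j)} _ _ eq = eq
unroll-injective n {zero} {suc (suc j)} _ _ ()
unroll-injective n {suc (suc i)} {zero} _ _ ()

fold≥3 : ∀ {M a} → 8 ≤ M → 3 ≤ a → a ≤ 5 → 3 ≤ fold M a
fold≥3 8≤M 3≤a a≤5 = ⊓-glb 3≤a (m+n≤o⇒m≤o∸n 3 (≤-trans (+-monoʳ-≤ 3 a≤5) 8≤M))

rim-dist-sym : ∀ n i j → rim-dist n i j ≡ rim-dist n j i
rim-dist-sym n i j = cong (fold (2 * n)) (∣-∣-comm i j)

rim-dist-from-1 : ∀ n → 4 ≤ n → ∀ j → j < 2 * n →
                  3 ≤ ∣ suc (2 * n) - j ∣ → ∣ suc (2 * n) - j ∣ ≤ 5 → 3 ≤ rim-dist n 1 j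
rim-dist-from-1 n n≥4 zero _ _ far = contradiction (≤-trans (2n≥8 n≥4) (<⇒≤ far)) (<⇒≱ (m≤m+n 6 2))
rim-dist-from-1 n n≥4 (suc j) 1+j<2n 3≤ ≤5 =
  subst (3 ≤_) (trans (cong (fold (2 * n)) (m≤n⇒∣n-m∣≡n∸m j≤2n)) (fold-mirror (2 * n) j≤2n))
        (fold≥3 (2n≥8 n≥4) 3≤ ≤5)
  where
  j≤2n : j ≤ 2 * n
  j≤2n = ≤-trans (n≤1+n j) (<⇒≤ 1+j<2n)

rim-dist-to-1 : ∀ n → 4 ≤ n → ∀ i → i < 2 * n →
                3 ≤ ∣ i - suc (2 * n) ∣ → ∣ i - suc (2 * n) ∣ ≤ 5 → 3 ≤ rim-dist n i 1
rim-dist-to-1 n n≥4 i i<2n 3≤ ≤5 rewrite ∣-∣-comm i (suc (2 * n)) | rim-dist-sym n i 1 =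
  rim-dist-from-1 n n≥4 i i<2n 3≤ ≤5

unrolled-rim-dist : ∀ n → 4 ≤ n → ∀ {i j} → i ≢ j → i < 2 * n → j < 2 * n →
                    3 ≤ ∣ unroll n i - unroll n j ∣ → ∣ unroll n i - unroll n j ∣ ≤ 5 →
                    3 ≤ rim-dist n i j
unrolled-rim-dist n n≥4 {zero} {zero} i≢j _ _ _ _ = contradiction refl i≢j
unrolled-rim-dist n n≥4 {suc zero} {suc zero} i≢j _ _ _ _ = contradiction refl i≢j
unrolled-rim-dist n n≥4 {suc zero} {zero} _ _ j<2n 3≤ ≤5 = rim-dist-from-1 n n≥4 0 j<2n 3≤ ≤5
unrolled-rim-dist n n≥4 {suc zero} {suc (suc j)} _ _ j<2n 3≤ ≤5 = rim-dist-from-1 n n≥4 (2 + j) j<2n 3≤ ≤5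
unrolled-rim-dist n n≥4 {zero} {suc zero} _ i<2n _ 3≤ ≤5 = rim-dist-to-1 n n≥4 0 i<2n 3≤ ≤5
unrolled-rim-dist n n≥4 {suc (suc i)} {suc zero} _ i<2n _ 3≤ ≤5 = rim-dist-to-1 n n≥4 (2 + i) i<2n 3≤ ≤5
unrolled-rim-dist n n≥4 {zero} {suc (suc j)} _ _ _ 3≤ ≤5 = fold≥3 (2n≥8 n≥4) 3≤ ≤5
unrolled-rim-dist n n≥4 {suc (suc i)} {zero} _ _ _ 3≤ ≤5 = fold≥3 (2n≥8 n≥4) 3≤ ≤5
unrolled-rim-dist n n≥4 {suc (suc i)} {suc (suc j)} _ _ _ 3≤ ≤5 = fold≥3 (2n≥8 n≥4) 3≤ ≤5

label : ∀ n → Vertex n → ℕ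
label n hub = 1
label n (rim i) = ℓ (unroll n (toℕ i))

rim-radio : ∀ n → 4 ≤ n → ∀ {i j} → i ≢ j → i < 2 * n → j < 2 * n →
            5 ≤ rim-dist n i j ⊓ (spoke i + spoke j) + ∣ ℓ (unroll n i) - ℓ (unroll n j) ∣
rim-radio n n≥4 {i} {j} i≢j i<2n j<2n
  with separated (unroll n i) (unroll n j) (i≢j ∘ unroll-injective n i<2n j<2n)
... | inj₁ labels-4-apart =
  +-mono-≤ (⊓-glb (rim-dist-pos n i≢j i<2n j<2n) (s≤s z≤n)) labels-4-apart
... | inj₂ (3≤ , ≤5 , opposite-parity , labels-2-apart) =
  +-mono-≤ (⊓-glb (unrolled-rim-dist n n≥4 i≢j i<2n j<2n 3≤ ≤5)
                  (subst (3 ≤_) (cong₂ _+_ (spoke-unroll n i) (spoke-unroll n j)) opposite-parity))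
           labels-2-apart

ℓ-pos : ∀ i → i ≢ 1 → 1 ≤ ℓ i
ℓ-pos zero _ = s≤s z≤n
ℓ-pos (suc zero) 1≢1 = contradiction refl 1≢1
ℓ-pos (suc (suc i)) _ = s≤s z≤n

ℓ-spoke : ∀ i → i ≢ 1 → 6 ≤ spoke i + ℓ i
ℓ-spoke zero _ = m≤m+n 6 1
ℓ-spoke (suc zero) 1≢1 = contradiction refl 1≢1
ℓ-spoke (suc (suc zero)) _ = m≤m+n 6 5
ℓ-spoke (suc (suc (suc zero))) _ = ≤-refl
ℓ-spoke (suc (suc (suc (suc i)))) _ =
  ≤-trans (ℓ-spoke (suc (suc i)) λ ()) (+-monoʳ-≤ (spoke i) (m≤n+m (ℓ (suc (suc i))) 4))

-- Unrolled positions are never 1, so no vertex gets the label ℓ 1 = 0.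
unroll≢1 : ∀ n → 1 ≤ n → ∀ i → unroll n i ≢ 1
unroll≢1 (suc m) _ zero ()
unroll≢1 (suc m) _ (suc zero) ()
unroll≢1 (suc m) _ (suc (suc i)) ()

hub-radio : ∀ a b → 6 ≤ a + b → 5 ≤ a + ∣ 1 - b ∣
hub-radio a zero 6≤a+0 = ≤-trans (≤-trans (n≤1+n 5) (subst (6 ≤_) (+-identityʳ a) 6≤a+0)) (m≤m+n a 1)
hub-radio a (suc b) 6≤a+1+b = ≤-pred (subst (6 ≤_) (+-suc a b) 6≤a+1+b)

label-radio : ∀ n → 4 ≤ n → ∀ u v → u ≢ v → 5 ≤ gear-lb n u v + ∣ label n u - label n v ∣
label-radio n n≥4 hub hub u≢v = contradiction refl u≢v
label-radio n n≥4 hub (rim j) _ = hub-radio (spoke (toℕ j)) (ℓ (unroll n (toℕ j)))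
  (subst (λ s → 6 ≤ s + ℓ (unroll n (toℕ j))) (spoke-unroll n (toℕ j))
         (ℓ-spoke (unroll n (toℕ j)) (unroll≢1 n (≤-trans (s≤s z≤n) n≥4) (toℕ j))))
label-radio n n≥4 (rim i) hub _ =
  subst (λ d → 5 ≤ spoke (toℕ i) + d) (∣-∣-comm 1 (ℓ (unroll n (toℕ i))))
        (label-radio n n≥4 hub (rim i) λ ())
label-radio n n≥4 (rim i) (rim j) i≢j =
  rim-radio n n≥4 (i≢j ∘ cong rim ∘ FinP.toℕ-injective) (FinP.toℕ<n i) (FinP.toℕ<n j)

gear-lb≤4 : ∀ n u v → gear-lb n u v ≤ 4
gear-lb≤4 n hub hub = z≤n
gear-lb≤4 n hub (rim j) = m≤n⇒m≤o+n 2 (spoke≤2 (toℕ j))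
gear-lb≤4 n (rim i) hub = m≤n⇒m≤o+n 2 (spoke≤2 (toℕ i))
gear-lb≤4 n (rim i) (rim j) = ≤-trans (m⊓n≤n _ _) (+-mono-≤ (spoke≤2 (toℕ i)) (spoke≤2 (toℕ j)))

-- Equal labels at distinct vertices would violate the radio condition, since
-- gear-lb never exceeds 4.
label-injective : ∀ n → 4 ≤ n → ∀ u v → label n u ≡ label n v → u ≡ v
label-injective n n≥4 u v same with u F.≟ v
... | yes u≡v = u≡v
... | no u≢v = contradiction (label-radio n n≥4 u v u≢v) (<⇒≱ (s≤s (begin
    gear-lb n u v + ∣ label n u - label n v ∣ ≡⟨ cong (λ l → gear-lb n u v + ∣ l - label n v ∣) same ⟩
    gear-lb n u v + ∣ label n v - label n v ∣ ≡⟨ cong (gear-lb n u v +_) (∣n-n∣≡0 (label n v)) ⟩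
    gear-lb n u v + 0                         ≡⟨ +-identityʳ _ ⟩
    gear-lb n u v                             ≤⟨ gear-lb≤4 n u v ⟩
    4                                         ∎)))
  where open ≤-Reasoning

label-positive : ∀ n → 1 ≤ n → ∀ u → 1 ≤ label n u
label-positive n n≥1 hub = ≤-refl
label-positive n n≥1 (rim i) = ℓ-pos (unroll n (toℕ i)) (unroll≢1 n n≥1 (toℕ i))

-- The labeling is a radio labeling, since gear-lb ≤ d.
label-is-radio : ∀ n → 4 ≤ n → IsRadioLabeling (gear n) 4 (label n)
label-is-radio n n≥4 =
  label-positive n (≤-trans (s≤s z≤n) n≥4) , label-injective n n≥4 ,
  λ u v k u≢v d → ≤-trans (label-radio n n≥4 u v u≢v) (+-monoˡ-≤ _ (gear-lb-≤ n (proj₁ d)))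

2*n≡n+n : ∀ n → 2 * n ≡ n + n
2*n≡n+n n = cong (n +_) (+-identityʳ n)

ℓ-even : ∀ m → ℓ (m + m) ≡ m * 4 + 6
ℓ-even zero = refl
ℓ-even (suc m) rewrite +-suc m m = cong (4 +_) (ℓ-even m)

ℓ-odd : ∀ m → ℓ (suc (m + m)) ≡ m * 4
ℓ-odd zero = refl
ℓ-odd (suc m) rewrite +-suc m m = cong (4 +_) (ℓ-odd m)

ℓ-bound : ∀ j m → j < m + m → ℓ j ≤ m * 4 + 2
ℓ-bound zero (suc m) _ = +-monoʳ-≤ 4 (m≤n+m 2 (m * 4))
ℓ-bound (suc zero) m _ = z≤n
ℓ-bound (suc (suc j)) (suc m) (s≤s j<) rewrite +-suc m m = +-monoʳ-≤ 4 (ℓ-bound j m (≤-pred j<))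

label≤ : ∀ n u → label n u ≤ 4 * n + 2
label≤ n hub = m≤n⇒m≤o+n (4 * n) (s≤s z≤n)
label≤ n (rim i) = subst (λ b → ℓ (unroll n (toℕ i)) ≤ b + 2) (*-comm n 4)
                         (rim-label≤ (toℕ i) (FinP.toℕ<n i))
  where
  rim-label≤ : ∀ j → j < 2 * n → ℓ (unroll n j) ≤ n * 4 + 2
  rim-label≤ (suc zero) _ = ≤-trans (≤-reflexive (trans (cong (ℓ ∘ suc) (2*n≡n+n n)) (ℓ-odd n))) (m≤m+n (n * 4) 2)
  rim-label≤ zero j<2n = ℓ-bound zero n (subst (zero <_) (2*n≡n+n n) j<2n)
  rim-label≤ (suc (suc j)) j<2n = ℓ-bound (2 + j) n (subst (2 + j <_) (2*n≡n+n n) j<2n)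

-- The largest label 4n + 2 is used, at x_{2n-2}.
label-attains : ∀ n → 2 ≤ n → ∃[ u ] label n u ≡ 4 * n + 2
label-attains (suc (suc m)) (s≤s (s≤s z≤n)) = rim x , trans (cong (ℓ ∘ unroll (2 + m)) index) top
  where
  bound : 2 + (m + m) < 2 * (2 + m)
  bound = subst (3 + (m + m) ≤_) (double m) (n≤1+n _)
    where
    double : ∀ m → 4 + (m + m) ≡ 2 * (2 + m)
    double = solve-∀
  x : Fin (2 * (2 + m))
  x = F.fromℕ< bound
  index : toℕ x ≡ 2 + (m + m)
  index = FinP.toℕ-fromℕ< bound
  top : ℓ (2 + (m + m)) ≡ 4 * (2 + m) + 2
  top = trans (cong (4 +_) (ℓ-even m)) (reorder m)
    where
    reorder : ∀ m → 4 + (m * 4 + 6) ≡ 4 * (2 + m) + 2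
    reorder = solve-∀

span-label : ∀ n → 2 ≤ n → span (label n) ≡ 4 * n + 2
span-label n n≥2 with label-attains n n≥2
... | u , top = ≤-antisym (max-≤ (label n) (label≤ n) (allFin _))
                          (subst (_≤ span (label n)) top (≤-span (label n) u))

spoke-sum : ℕ → ℕ
spoke-sum k = sum (tabulate {n = k} (spoke ∘ toℕ))

-- Each pair of consecutive positions contributes 1 + 2.
spoke-sum-double : ∀ m → spoke-sum (m + m) ≡ m * 3
spoke-sum-double zero = refl
spoke-sum-double (suc m) = trans (cong (spoke-sum ∘ suc) (+-suc m m)) (cong (3 +_) (spoke-sum-double m))

height-sum : ∀ n → sum (map (height n) (allFin (suc (2 * n)))) ≡ n * 3
height-sum n = begin
  sum (map (height n) (allFin (suc (2 * n)))) ≡⟨ cong sum (map-tabulate (λ u → u) (height n)) ⟩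
  spoke-sum (2 * n)                           ≡⟨ cong spoke-sum (2*n≡n+n n) ⟩
  spoke-sum (n + n)                           ≡⟨ spoke-sum-double n ⟩
  n * 3                                       ∎
  where open ≡-Reasoning

height-pair : ∀ n {x z} → x ≢ z → 1 ≤ height n x + height n z
height-pair n {hub} {hub} x≢z = contradiction refl x≢z
height-pair n {hub} {rim k} _ = s≤s z≤n
height-pair n {rim i} _ = s≤s z≤n

-- Every radio labeling of G_n has span at least 4n + 2: here Σ height = 3n.
span-lower-bound : ∀ n → 4 ≤ n → ∀ c → IsRadioLabeling (gear n) 4 c → 4 * n + 2 ≤ span c
span-lower-bound n n≥4 c radio
  with RadioLowerBound.span-bound (height n) (gear-dist-via-hub n) radio (≤-trans (s≤s z≤n) (2n≥8 n≥4))
... | x , z , x≢z , bound = +-cancelʳ-≤ (2 * (n * 3)) _ _ (begin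
    4 * n + 2 + 2 * (n * 3)                      ≡⟨ arrange n ⟩
    1 + 2 * n * 5 + 1                            ≤⟨ +-mono-≤ (+-monoˡ-≤ (2 * n * 5) (proj₁ radio x)) (height-pair n x≢z) ⟩
    c x + 2 * n * 5 + (height n x + height n z)  ≡⟨ +-assoc (c x + 2 * n * 5) _ _ ⟨
    c x + 2 * n * 5 + height n x + height n z    ≤⟨ bound ⟩
    span c + 2 * sum (map (height n) (allFin (suc (2 * n)))) ≡⟨ cong (λ s → span c + 2 * s) (height-sum n) ⟩
    span c + 2 * (n * 3)                         ∎)
  where
  open ≤-Reasoning
  arrange : ∀ n → 4 * n + 2 + 2 * (n * 3) ≡ 1 + 2 * n * 5 + 1
  arrange = solve-∀

theorem2p3 : (n : ℕ) → 4 ≤ n →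
    ∃[ D ] (IsDiam (gear n) D × RadioNumberIs (gear n) D (4 * n + 2))
theorem2p3 n n≥4 =
  4 , gear-diameter n n≥4 ,
  (label n , label-is-radio n n≥4 , span-label n (≤-trans (s≤s (s≤s z≤n)) n≥4)) ,
  span-lower-bound n n≥4
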